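{- For any two positive integers $d$ and $n$, there exists a graph $G$ with $\chi(G)\ge n/d$ and $\operatorname{rank}(A_G)\le\nu_d(n)+1$.
   Context: Graphs are finite, simple and undirected; $A_G$ is the adjacency matrix, $I$ the identity, rank over $\mathbb{R}$, $\chi$ the chromatic number, $\omega$ the clique number. $\nu_d(n)$ is the minimum of $\operatorname{rank}(A_G+I)$ over all $n$-vertex graphs $G$ with $\omega(G)\le d$. -}

module Defs where

open import Data.Nat using (ℕ; zero; suc; _≤_; _*_)
open import Data.Fin using (Fin; zero; suc; _≟_)
open import Data.Bool using (Bool; true; false; if_then_else_)
open import Data.Rational using (ℚ; 0ℚ; 1ℚ) renaming (_+_ to _+ℚ_; _*_ to _*ℚ_)
open import Data.Product using (Σ; ∃; _×_; _,_)
open import Relation.Nullary using (¬_; yes; no)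
open import Relation.Binary.PropositionalEquality using (_≡_; _≢_)

record Graph (n : ℕ) : Set where
  field
    adj   : Fin n → Fin n → Bool
    sym   : ∀ i j → adj i j ≡ adj j i
    irrefl : ∀ i → adj i i ≡ false
open Graph public

Matrix : ℕ → Set
Matrix n = Fin n → Fin n → ℚ

adjMatrix : ∀ {n} → Graph n → Matrix n
adjMatrix G i j = if adj G i j then 1ℚ else 0ℚ

adjMatrixPlusId : ∀ {n} → Graph n → Matrix n
adjMatrixPlusId G i j with i ≟ j
... | yes _ = 1ℚ
... | no _  = adjMatrix G i j

sumFin : ∀ k → (Fin k → ℚ) → ℚ
sumFin zero    f = 0ℚ
sumFin (suc k) f = f zero +ℚ sumFin k (λ i → f (suc i))

IndependentRows : ∀ {n k} → Matrix n → (Fin k → Fin n) → Set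
IndependentRows {n} {k} M r =
  ∀ (c : Fin k → ℚ) →
    (∀ j → sumFin k (λ i → c i *ℚ M (r i) j) ≡ 0ℚ) → ∀ i → c i ≡ 0ℚ

HasIndependentRows : ∀ {n} → Matrix n → ℕ → Set
HasIndependentRows {n} M k = Σ (Fin k → Fin n) λ r → IndependentRows M r

IsRank : ∀ {n} → Matrix n → ℕ → Set
IsRank M r = HasIndependentRows M r × ¬ HasIndependentRows M (suc r)

IsClique : ∀ {n k} → Graph n → (Fin k → Fin n) → Set
IsClique {n} {k} G f = ∀ (a b : Fin k) → a ≢ b → adj G (f a) (f b) ≡ true

CliqueNumberAtMost : ∀ {n} → Graph n → ℕ → Set
CliqueNumberAtMost {n} G d = ¬ (Σ (Fin (suc d) → Fin n) λ f → IsClique G f)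

ProperColoring : ∀ {n} → Graph n → ℕ → Set
ProperColoring {n} G k =
  Σ (Fin n → Fin k) λ c → ∀ i j → adj G i j ≡ true → c i ≢ c j

IsChromaticNumber : ∀ {n} → Graph n → ℕ → Set
IsChromaticNumber G c = ProperColoring G c × (∀ k → ProperColoring G k → c ≤ k)

IsNu : ℕ → ℕ → ℕ → Set
IsNu d n v =
  (Σ (Graph n) λ G → CliqueNumberAtMost G d × IsRank (adjMatrixPlusId G) v)
  × (∀ (G : Graph n) (r : ℕ) → CliqueNumberAtMost G d →
       IsRank (adjMatrixPlusId G) r → v ≤ r)

{-# OPTIONS --safe #-}
module Submission where

-- Let H attain ν_d(n) and let G be its complement. Since A_G = J − (A_H + I), every row of
-- A_G lies in the span of the all-ones vector and the rows of A_H + I, so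
-- rank(A_G) ≤ rank(A_H + I) + 1. A colour class of G is a clique of H, hence has at most
-- d vertices, so n ≤ χ(G) · d.

open import Defs hiding (sym)

module FiniteSearch where

  open import Data.Fin using (Fin; zero; suc)
  open import Data.Fin.Properties using (any?)
  open import Data.Nat using (ℕ; zero; suc; _≤_; z≤n; s≤s)
  open import Data.Product using (Σ; _×_; _,_)
  open import Data.Vec.Functional using (_∷_; head; tail)
  open import Function using (_∘_)
  open import Relation.Binary.PropositionalEquality using (_≡_; refl)
  open import Relation.Nullary using (Dec; yes; no; contradiction)
  open import Relation.Nullary.Decidable as Dec using ()
  open import Relation.Unary using (Decidable)

  least : ∀ {P : ℕ → Set} → Decidable P → ∀ {n} → P n → Σ ℕ λ c → P c × (∀ k → P k → c ≤ k)
  least P? p with P? 0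
  ... | yes p₀ = 0 , p₀ , λ _ _ → z≤n
  least P? {zero}  p | no ¬p₀ = contradiction p ¬p₀
  least P? {suc n} p | no ¬p₀ with least (P? ∘ suc) p
  ... | c , pc , minimal = suc c , pc , λ { zero p₀ → contradiction p₀ ¬p₀
                                          ; (suc k) pk → s≤s (minimal k pk) }

  any-function? : ∀ m {n} {P : (Fin m → Fin n) → Set} →
                  (∀ {f g} → (∀ i → f i ≡ g i) → P f → P g) →
                  (∀ f → Dec (P f)) → Dec (Σ (Fin m → Fin n) P)
  any-function? zero {n} resp P? = Dec.map′ (empty ,_) (λ (_ , p) → resp (λ ()) p) (P? empty)
    where
    empty : Fin 0 → Fin n
    empty ()
  any-function? (suc m) resp P? =
    Dec.map′ (λ (a , f , p) → (a ∷ f) , p)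
             (λ (f , p) → head f , tail f , resp (λ { zero → refl ; (suc i) → refl }) p)
             (any? λ a → any-function? m (λ f≗g → resp (λ { zero → refl ; (suc i) → f≗g i }))
                                         (P? ∘ (a ∷_)))

module LinearAlgebra where

  open import Algebra.Bundles using (Ring)
  open import Data.Fin using (Fin; zero; suc; punchIn; punchOut; _≟_)
  open import Data.Fin.Properties using (all?; ¬∀⟶∃¬; punchIn-punchOut)
  open import Data.Nat using (ℕ; zero; suc; _≤_; z≤n; s≤s)
  open import Data.Nat.Properties using (m≤n⇒m≤1+n; 1+n≰n)
  open import Data.Product using (Σ; ∃; _×_; _,_; proj₁; proj₂)
  open import Data.Rational using (ℚ; 0ℚ; 1ℚ; _+_; _*_; -_; _-_; 1/_; ≢-nonZero)
  open import Data.Rational.Properties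
    using ( +-*-ring; *-identityˡ; *-identityʳ; *-assoc; *-inverseʳ; *-inverseˡ; *-zeroˡ; *-zeroʳ
          ; +-identityʳ)
    renaming (_≟_ to _≟ℚ_)
  open import Data.Rational.Solver using (module +-*-Solver)
  open import Data.Sum using (_⊎_; inj₁; inj₂)
  open import Data.Vec.Functional using (Vector; removeAt; insertAt; _∷_; tail)
  open import Data.Vec.Functional.Properties using (insertAt-lookup; insertAt-punchIn)
  open import Function using (_∘_)
  open import Relation.Binary.PropositionalEquality
    using (_≡_; _≢_; refl; sym; trans; cong; cong₂; subst; module ≡-Reasoning)
  open import Relation.Nullary using (¬_; Dec; yes; no; contradiction; ¬?)
  open import Relation.Nullary.Decidable as Dec using (decidable-stable)

  open import Algebra.Properties.Semiring.Sum (Ring.semiring +-*-ring)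
  open import Algebra.Properties.Group (Ring.+-group +-*-ring) using (inverseʳ-unique)
  open +-*-Solver
  open FiniteSearch

  sumFin≡sum : ∀ k (f : Vector ℚ k) → sumFin k f ≡ sum f
  sumFin≡sum zero    f = refl
  sumFin≡sum (suc k) f = cong (f zero +_) (sumFin≡sum k (tail f))

  x*y≡0⇒x≡0 : ∀ {p} q → q ≢ 0ℚ → p * q ≡ 0ℚ → p ≡ 0ℚ
  x*y≡0⇒x≡0 {p} q q≢0 pq≡0 = begin
    p                ≡⟨ sym (*-identityʳ p) ⟩
    p * 1ℚ           ≡⟨ cong (p *_) (sym (*-inverseʳ q)) ⟩
    p * (q * 1/ q)   ≡⟨ sym (*-assoc p q (1/ q)) ⟩
    (p * q) * 1/ q   ≡⟨ cong (_* 1/ q) pq≡0 ⟩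
    0ℚ * 1/ q        ≡⟨ *-zeroˡ (1/ q) ⟩
    0ℚ               ∎
    where open ≡-Reasoning
          instance _ = ≢-nonZero q≢0

  punchIn-elim : ∀ {n} {P : Fin (suc n) → Set} (i : Fin (suc n)) →
                 P i → (∀ j → P (punchIn i j)) → ∀ j → P j
  punchIn-elim {P = P} i pi p-punchIn j with j ≟ i
  ... | yes refl = pi
  ... | no j≢i   = subst P (punchIn-punchOut (j≢i ∘ sym)) (p-punchIn (punchOut (j≢i ∘ sym)))

  linComb : ∀ {k n} → Vector ℚ k → (Fin k → Vector ℚ n) → Vector ℚ n
  linComb {k} c u j = sum (λ i → c i * u i j)

  Independent : ∀ {k n} → (Fin k → Vector ℚ n) → Set
  Independent u = ∀ c → (∀ j → linComb c u j ≡ 0ℚ) → ∀ i → c i ≡ 0ℚ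

  Dependent : ∀ {k n} → (Fin k → Vector ℚ n) → Set
  Dependent u = ∃ λ c → (∀ j → linComb c u j ≡ 0ℚ) × ∃ λ i → c i ≢ 0ℚ

  linComb-zeroˡ : ∀ {k n} {c : Vector ℚ k} (u : Fin k → Vector ℚ n) →
                  (∀ i → c i ≡ 0ℚ) → ∀ j → linComb c u j ≡ 0ℚ
  linComb-zeroˡ {k} u c≡0 j = trans
    (sum-cong-≗ λ i → trans (cong (_* u i j) (c≡0 i)) (*-zeroˡ (u i j)))
    (sum-replicate-zero k)

  linComb-zeroʳ : ∀ {k n} (c : Vector ℚ k) {u : Fin k → Vector ℚ n} {j} →
                  (∀ i → u i j ≡ 0ℚ) → linComb c u j ≡ 0ℚ
  linComb-zeroʳ {k} c u≡0 = trans
    (sum-cong-≗ λ i → trans (cong (c i *_) (u≡0 i)) (*-zeroʳ (c i)))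
    (sum-replicate-zero k)

  sum-linear : ∀ {k} (c x y : Vector ℚ k) a b →
    sum (λ i → c i * (a * x i + b * y i)) ≡
    a * sum (λ i → c i * x i) + b * sum (λ i → c i * y i)
  sum-linear c x y a b = begin
    sum (λ i → c i * (a * x i + b * y i))
      ≡⟨ sum-cong-≗ (λ i →
           solve 5 (λ c x y a b → c :* (a :* x :+ b :* y) := a :* (c :* x) :+ b :* (c :* y))
                   refl (c i) (x i) (y i) a b) ⟩
    sum (λ i → a * (c i * x i) + b * (c i * y i))
      ≡⟨ ∑-distrib-+ (λ i → a * (c i * x i)) (λ i → b * (c i * y i)) ⟩
    sum (λ i → a * (c i * x i)) + sum (λ i → b * (c i * y i))
      ≡⟨ sym (cong₂ _+_ (*-distribˡ-sum a (λ i → c i * x i))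
                        (*-distribˡ-sum b (λ i → c i * y i))) ⟩
    a * sum (λ i → c i * x i) + b * sum (λ i → c i * y i) ∎
    where open ≡-Reasoning

  -- One step of fraction-free Gaussian elimination: the pivot vector u i₀ clears the
  -- first coordinate of the others.
  module Pivot {k n} (u : Fin (suc k) → Vector ℚ (suc n))
               (i₀ : Fin (suc k)) (p≢0 : u i₀ zero ≢ 0ℚ) where

    p : ℚ
    p = u i₀ zero

    others : Fin k → Vector ℚ (suc n)
    others = removeAt u i₀

    reduced : Fin k → Vector ℚ n
    reduced l j = p * others l (suc j) + (- u i₀ (suc j)) * others l zero

    linComb-reduced : ∀ c j → linComb c reduced j ≡
      p * linComb c others (suc j) + (- u i₀ (suc j)) * linComb c others zero
    linComb-reduced c j = sum-linear c _ _ p (- u i₀ (suc j))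

    linComb-removeAt : ∀ c j → linComb c u j ≡ c i₀ * u i₀ j + linComb (removeAt c i₀) others j
    linComb-removeAt c j = sum-remove {i = i₀} (λ i → c i * u i j)

    liftDependent : Dependent reduced → Dependent u
    liftDependent (c′ , c′·reduced≡0 , l , c′l≢0) = c , c·u≡0 , punchIn i₀ l , cl≢0
      where
      S : ℚ
      S = linComb c′ others zero
      c : Vector ℚ (suc k)
      c = insertAt (λ l → c′ l * p) i₀ (- S)
      c·u : ∀ j → linComb c u j ≡ p * linComb c′ others j + (- u i₀ j) * S
      c·u j = begin
        linComb c u j
          ≡⟨ linComb-removeAt c j ⟩
        c i₀ * u i₀ j + sum (λ l → c (punchIn i₀ l) * others l j)
          ≡⟨ cong₂ _+_ (cong (_* u i₀ j) (insertAt-lookup _ i₀ (- S)))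
                       (sum-cong-≗ λ l → cong (_* others l j) (insertAt-punchIn _ i₀ (- S) l)) ⟩
        (- S) * u i₀ j + sum (λ l → (c′ l * p) * others l j)
          ≡⟨ cong ((- S) * u i₀ j +_) (sum-cong-≗ λ l →
               solve 3 (λ c p x → (c :* p) :* x := p :* (c :* x)) refl (c′ l) p (others l j)) ⟩
        (- S) * u i₀ j + sum (λ l → p * (c′ l * others l j))
          ≡⟨ cong ((- S) * u i₀ j +_) (sym (*-distribˡ-sum p (λ l → c′ l * others l j))) ⟩
        (- S) * u i₀ j + p * linComb c′ others j
          ≡⟨ solve 4 (λ s x p l → (:- s) :* x :+ p :* l := p :* l :+ (:- x) :* s)
                     refl S (u i₀ j) p (linComb c′ others j) ⟩
        p * linComb c′ others j + (- u i₀ j) * S ∎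
        where open ≡-Reasoning
      c·u≡0 : ∀ j → linComb c u j ≡ 0ℚ
      c·u≡0 zero    = trans (c·u zero) (solve 2 (λ p s → p :* s :+ (:- p) :* s := con 0ℚ) refl p S)
      c·u≡0 (suc j) = trans (c·u (suc j)) (trans (sym (linComb-reduced c′ j)) (c′·reduced≡0 j))
      cl≢0 : c (punchIn i₀ l) ≢ 0ℚ
      cl≢0 cl≡0 = c′l≢0 (x*y≡0⇒x≡0 p p≢0 (trans (sym (insertAt-punchIn _ i₀ (- S) l)) cl≡0))

    liftIndependent : Independent reduced → Independent u
    liftIndependent reduced-indep c c·u≡0 = punchIn-elim i₀ ci₀≡0 c′≡0
      where
      c′ : Vector ℚ k
      c′ = removeAt c i₀
      c′·others : ∀ j → linComb c′ others j ≡ - (c i₀ * u i₀ j)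
      c′·others j = inverseʳ-unique _ _ (trans (sym (linComb-removeAt c j)) (c·u≡0 j))
      c′·reduced≡0 : ∀ j → linComb c′ reduced j ≡ 0ℚ
      c′·reduced≡0 j = begin
        linComb c′ reduced j
          ≡⟨ linComb-reduced c′ j ⟩
        p * linComb c′ others (suc j) + (- u i₀ (suc j)) * linComb c′ others zero
          ≡⟨ cong₂ (λ a b → p * a + (- u i₀ (suc j)) * b) (c′·others (suc j)) (c′·others zero) ⟩
        p * (- (c i₀ * u i₀ (suc j))) + (- u i₀ (suc j)) * (- (c i₀ * p))
          ≡⟨ solve 3 (λ p x c → p :* (:- (c :* x)) :+ (:- x) :* (:- (c :* p)) := con 0ℚ)
                     refl p (u i₀ (suc j)) (c i₀) ⟩
        0ℚ ∎
        where open ≡-Reasoning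
      c′≡0 : ∀ l → c′ l ≡ 0ℚ
      c′≡0 = reduced-indep c′ c′·reduced≡0
      ci₀≡0 : c i₀ ≡ 0ℚ
      ci₀≡0 = x*y≡0⇒x≡0 p p≢0 (begin
        c i₀ * p                           ≡⟨ sym (+-identityʳ (c i₀ * p)) ⟩
        c i₀ * p + 0ℚ                      ≡⟨ cong (c i₀ * p +_) (linComb-zeroˡ others c′≡0 zero) ⟨
        c i₀ * p + linComb c′ others zero  ≡⟨ linComb-removeAt c zero ⟨
        linComb c u zero                   ≡⟨ c·u≡0 zero ⟩
        0ℚ                                 ∎)
        where open ≡-Reasoning

  dependent⊎independent : ∀ {n k} (u : Fin k → Vector ℚ n) → Dependent u ⊎ (Independent u × k ≤ n)
  dependent⊎independent {zero} {zero} u = inj₂ ((λ _ _ ()) , z≤n)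
  dependent⊎independent {zero} {suc k} u = inj₁ ((λ _ → 1ℚ) , (λ ()) , zero , λ ())
  dependent⊎independent {suc n} {k} u with all? (λ i → u i zero ≟ℚ 0ℚ)
  ... | yes column≡0 with dependent⊎independent (λ i → tail (u i))
  ...   | inj₁ (c , c·tail≡0 , nonzero) =
          inj₁ (c , (λ { zero → linComb-zeroʳ c {u} column≡0 ; (suc j) → c·tail≡0 j }) , nonzero)
  ...   | inj₂ (indep , k≤n) = inj₂ ((λ c c·u≡0 → indep c (c·u≡0 ∘ suc)) , m≤n⇒m≤1+n k≤n)
  dependent⊎independent {suc n} {zero} u | no column≢0 = contradiction (λ ()) column≢0
  dependent⊎independent {suc n} {suc k} u | no column≢0
    with ¬∀⟶∃¬ _ _ (λ i → u i zero ≟ℚ 0ℚ) column≢0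
  ... | i₀ , p≢0 with dependent⊎independent (Pivot.reduced u i₀ p≢0)
  ...   | inj₁ dep           = inj₁ (Pivot.liftDependent u i₀ p≢0 dep)
  ...   | inj₂ (indep , k≤n) = inj₂ (Pivot.liftIndependent u i₀ p≢0 indep , s≤s k≤n)

  module _ {k n} {u : Fin k → Vector ℚ n} where

    dependent⇒¬independent : Dependent u → ¬ Independent u
    dependent⇒¬independent (c , c·u≡0 , i , ci≢0) indep = ci≢0 (indep c c·u≡0 i)

    ¬independent⇒dependent : ¬ Independent u → Dependent u
    ¬independent⇒dependent ¬indep with dependent⊎independent u
    ... | inj₁ dep         = dep
    ... | inj₂ (indep , _) = contradiction indep ¬indep

    independent? : Dec (Independent u)
    independent? with dependent⊎independent u
    ... | inj₁ dep         = no (dependent⇒¬independent dep)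
    ... | inj₂ (indep , _) = yes indep

    independent⇒≤ : Independent u → k ≤ n
    independent⇒≤ indep with dependent⊎independent u
    ... | inj₁ dep       = contradiction indep (dependent⇒¬independent dep)
    ... | inj₂ (_ , k≤n) = k≤n

  independent-cong : ∀ {k n} {u v : Fin k → Vector ℚ n} →
                     (∀ i j → u i j ≡ v i j) → Independent u → Independent v
  independent-cong u≡v indep c c·v≡0 =
    indep c (λ j → trans (sum-cong-≗ λ i → cong (c i *_) (u≡v i j)) (c·v≡0 j))

  _∈Span_ : ∀ {m n} → Vector ℚ n → (Fin m → Vector ℚ n) → Set
  x ∈Span X = ∃ λ α → ∀ j → x j ≡ linComb α X j

  linComb-assoc : ∀ {k m n} (c : Vector ℚ k) (α : Fin k → Vector ℚ m) (X : Fin m → Vector ℚ n) j →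
                  linComb c (λ i → linComb (α i) X) j ≡ linComb (linComb c α) X j
  linComb-assoc c α X j = begin
    sum (λ i → c i * sum (λ l → α i l * X l j))
      ≡⟨ sum-cong-≗ (λ i → *-distribˡ-sum (c i) (λ l → α i l * X l j)) ⟩
    sum (λ i → sum (λ l → c i * (α i l * X l j)))
      ≡⟨ ∑-comm (λ i l → c i * (α i l * X l j)) ⟩
    sum (λ l → sum (λ i → c i * (α i l * X l j)))
      ≡⟨ sum-cong-≗ (λ l → sum-cong-≗ λ i → sym (*-assoc (c i) (α i l) (X l j))) ⟩
    sum (λ l → sum (λ i → (c i * α i l) * X l j))
      ≡⟨ sum-cong-≗ (λ l → sym (*-distribʳ-sum (X l j) (λ i → c i * α i l))) ⟩
    sum (λ l → linComb c α l * X l j) ∎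
    where open ≡-Reasoning

  relation⇒∈Span : ∀ {m n} {x : Vector ℚ n} {X : Fin m → Vector ℚ n} {c : Vector ℚ (suc m)} →
                   c zero ≢ 0ℚ → (∀ j → linComb c (x ∷ X) j ≡ 0ℚ) → x ∈Span X
  relation⇒∈Span {x = x} {X} {c} c₀≢0 c·xX≡0 = (λ l → a * c (suc l)) , λ j → sym (begin
    sum (λ l → (a * c (suc l)) * X l j)
      ≡⟨ sum-cong-≗ (λ l → *-assoc a (c (suc l)) (X l j)) ⟩
    sum (λ l → a * (c (suc l) * X l j))
      ≡⟨ sym (*-distribˡ-sum a (λ l → c (suc l) * X l j)) ⟩
    a * linComb (tail c) X j
      ≡⟨ cong (a *_) (inverseʳ-unique _ _ (c·xX≡0 j)) ⟩
    (- 1/ c zero) * (- (c zero * x j))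
      ≡⟨ solve 3 (λ a b x → (:- a) :* (:- (b :* x)) := (a :* b) :* x) refl (1/ c zero) (c zero) (x j) ⟩
    (1/ c zero * c zero) * x j
      ≡⟨ cong (_* x j) (*-inverseˡ (c zero)) ⟩
    1ℚ * x j
      ≡⟨ *-identityˡ (x j) ⟩
    x j ∎)
    where
    open ≡-Reasoning
    instance _ = ≢-nonZero c₀≢0
    a : ℚ
    a = - 1/ c zero

  independent-extension : ∀ {m n} {x : Vector ℚ n} {X : Fin m → Vector ℚ n} →
                          Independent X → ¬ Independent (x ∷ X) → x ∈Span X
  independent-extension {x = x} {X} indep ¬indep with ¬independent⇒dependent {u = x ∷ X} ¬indep
  ... | c , c·xX≡0 , i , ci≢0 with c zero ≟ℚ 0ℚ
  ...   | no c₀≢0  = relation⇒∈Span {c = c} c₀≢0 c·xX≡0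
  ...   | yes c₀≡0 = contradiction (c≡0 i) ci≢0
    where
    tail-c≡0 : ∀ l → c (suc l) ≡ 0ℚ
    tail-c≡0 = indep (tail c) λ j → begin
      linComb (tail c) X j                ≡⟨ solve 2 (λ a b → b := con 0ℚ :* a :+ b) refl (x j) _ ⟩
      0ℚ * x j + linComb (tail c) X j     ≡⟨ cong (λ a → a * x j + linComb (tail c) X j) (sym c₀≡0) ⟩
      linComb c (x ∷ X) j                 ≡⟨ c·xX≡0 j ⟩
      0ℚ                                  ∎
      where open ≡-Reasoning
    c≡0 : ∀ l → c l ≡ 0ℚ
    c≡0 zero    = c₀≡0
    c≡0 (suc l) = tail-c≡0 l

  independent-in-span⇒≤ : ∀ {k m n} {u : Fin k → Vector ℚ n} {X : Fin m → Vector ℚ n} →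
                          Independent u → (∀ i → u i ∈Span X) → k ≤ m
  independent-in-span⇒≤ {u = u} {X} indep spans with dependent⊎independent (λ i → proj₁ (spans i))
  ... | inj₂ (_ , k≤m) = k≤m
  ... | inj₁ (c , c·α≡0 , i , ci≢0) = contradiction (indep c c·u≡0 i) ci≢0
    where
    α : Fin _ → Vector ℚ _
    α i = proj₁ (spans i)
    c·u≡0 : ∀ j → linComb c u j ≡ 0ℚ
    c·u≡0 j = begin
      linComb c u j                        ≡⟨ sum-cong-≗ (λ i → cong (c i *_) (proj₂ (spans i) j)) ⟩
      linComb c (λ i → linComb (α i) X) j  ≡⟨ linComb-assoc c α X j ⟩
      linComb (linComb c α) X j            ≡⟨ linComb-zeroˡ X c·α≡0 j ⟩
      0ℚ                                   ∎
      where open ≡-Reasoning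

  1-∈Span : ∀ {m n} {x y : Vector ℚ n} {X : Fin m → Vector ℚ n} →
            (∀ j → y j ≡ 1ℚ - x j) → x ∈Span X → y ∈Span ((λ _ → 1ℚ) ∷ X)
  1-∈Span {x = x} {y} {X} y≡1-x (α , x≡α·X) = (1ℚ ∷ λ l → - α l) , λ j → begin
    y j
      ≡⟨ y≡1-x j ⟩
    1ℚ - x j
      ≡⟨ cong (λ s → 1ℚ - s) (x≡α·X j) ⟩
    1ℚ - linComb α X j
      ≡⟨ solve 1 (λ s → con 1ℚ :- s := con 1ℚ :* con 1ℚ :+ (:- con 1ℚ) :* s) refl (linComb α X j) ⟩
    1ℚ * 1ℚ + (- 1ℚ) * linComb α X j
      ≡⟨ cong (1ℚ * 1ℚ +_) (*-distribˡ-sum (- 1ℚ) (λ l → α l * X l j)) ⟩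
    1ℚ * 1ℚ + sum (λ l → (- 1ℚ) * (α l * X l j))
      ≡⟨ cong (1ℚ * 1ℚ +_) (sum-cong-≗ λ l →
           solve 2 (λ a x → (:- con 1ℚ) :* (a :* x) := (:- a) :* x) refl (α l) (X l j)) ⟩
    1ℚ * 1ℚ + sum (λ l → (- α l) * X l j) ∎
    where open ≡-Reasoning

  fromIndependentRows : ∀ {n k} (M : Matrix n) {r : Fin k → Fin n} →
                        IndependentRows M r → Independent (M ∘ r)
  fromIndependentRows {k = k} M indep c c·M≡0 =
    indep c (λ j → trans (sumFin≡sum k (λ i → c i * _)) (c·M≡0 j))

  toIndependentRows : ∀ {n k} (M : Matrix n) {r : Fin k → Fin n} →
                      Independent (M ∘ r) → IndependentRows M r
  toIndependentRows {k = k} M indep c c·M≡0 =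
    indep c (λ j → trans (sym (sumFin≡sum k (λ i → c i * _))) (c·M≡0 j))

  rank-rows-span : ∀ {n v} (M : Matrix n) → IsRank M v →
                   Σ (Fin v → Fin n) λ r → ∀ i → M i ∈Span (M ∘ r)
  rank-rows-span M ((r , indep) , ¬more) =
    r , λ i → independent-extension (fromIndependentRows M indep)
                (λ indep′ → ¬more ((i ∷ r) , toIndependentRows M {i ∷ r} indep′))

  rank≤ : ∀ {n m r} {M : Matrix n} {X : Fin m → Vector ℚ n} →
          IsRank M r → (∀ i → M i ∈Span X) → r ≤ m
  rank≤ {M = M} ((s , indep) , _) spans =
    independent-in-span⇒≤ (fromIndependentRows M indep) (spans ∘ s)

  rank[J-M]≤1+rank[M] : ∀ {n v r} {M B : Matrix n} → (∀ i j → B i j ≡ 1ℚ - M i j) →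
                        IsRank M v → IsRank B r → r ≤ suc v
  rank[J-M]≤1+rank[M] {M = M} {B} B≡J-M rankM rankB with rank-rows-span M rankM
  ... | s , spans =
    rank≤ {M = B} {X = (λ _ → 1ℚ) ∷ M ∘ s} rankB λ i → 1-∈Span (B≡J-M i) (spans i)

  hasIndependentRows? : ∀ {n} (M : Matrix n) k → Dec (HasIndependentRows M k)
  hasIndependentRows? {n} M k = any-function? k rows-cong λ r →
    Dec.map′ (toIndependentRows M) (fromIndependentRows M) independent?
    where
    rows-cong : ∀ {r s : Fin k → Fin n} → (∀ i → r i ≡ s i) →
                IndependentRows M r → IndependentRows M s
    rows-cong r≗s = toIndependentRows M ∘ independent-cong (λ i j → cong (λ x → M x j) (r≗s i))
                                         ∘ fromIndependentRows M

  ¬hasIndependentRows-suc : ∀ {n} (M : Matrix n) → ¬ HasIndependentRows M (suc n)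
  ¬hasIndependentRows-suc M (r , indep) =
    1+n≰n (independent⇒≤ {u = M ∘ r} (fromIndependentRows M {r} indep))

  -- The rank is the least k such that M has no k + 1 independent rows.
  rank-exists : ∀ {n} (M : Matrix n) → Σ ℕ (IsRank M)
  rank-exists M with least (λ k → ¬? (hasIndependentRows? M (suc k))) (¬hasIndependentRows-suc M)
  ... | zero  , none , _       = 0 , ((λ ()) , λ _ _ ()) , none
  ... | suc c , none , minimal =
    suc c , decidable-stable (hasIndependentRows? M (suc c)) (λ ¬has → 1+n≰n (minimal c ¬has)) , none

module Graphs where

  open import Data.Bool using (Bool; true; false; not)
  open import Data.Bool.Properties using () renaming (_≟_ to _≟ᵇ_)
  open import Data.Fin using (Fin; zero; suc; inject≤; toℕ; _≟_)
  open import Data.Fin.Properties using (all?; inject≤-injective; toℕ-injective; toℕ<n)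
  open import Data.List using (List; []; _∷_; length; lookup; filter)
  open import Data.List.Properties using (length-tabulate)
  open import Data.List.Membership.Propositional.Properties using (∈-lookup)
  open import Data.List.Relation.Unary.All as All using (All; _∷_)
  open import Data.List.Relation.Unary.All.Properties using (all-filter; filter⁺; tabulate⁺)
  open import Data.List.Relation.Unary.AllPairs using (_∷_)
  open import Data.List.Relation.Unary.Unique.Propositional using (Unique)
  import Data.List.Relation.Unary.Unique.Propositional.Properties as Unique
  open import Data.Nat as ℕ using (ℕ; zero; suc; _+_; _*_; _≤_; _<_; _≤?_; z≤n)
  open import Data.Nat.Properties using (≰⇒>; ≤∧≢⇒<; ≤-pred; +-suc; +-mono-≤; module ≤-Reasoning)
  open import Data.Product using (Σ; _,_)
  open import Data.Rational using (1ℚ; _-_)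
  open import Function using (_∘_; id)
  open import Relation.Binary.PropositionalEquality
    using (_≡_; _≢_; refl; sym; trans; cong; subst)
  open import Relation.Nullary using (Dec; yes; no; contradiction; ¬?)
  open import Relation.Nullary.Decidable using (_→-dec_)
  open import Relation.Unary using (Decidable)

  open FiniteSearch

  complement : ∀ {n} → Graph n → Graph n
  complement {n} H = record { adj = adjᶜ ; sym = symᶜ ; irrefl = irreflᶜ }
    where
    adjᶜ : Fin n → Fin n → Bool
    adjᶜ i j with i ≟ j
    ... | yes _ = false
    ... | no  _ = not (adj H i j)
    symᶜ : ∀ i j → adjᶜ i j ≡ adjᶜ j i
    symᶜ i j with i ≟ j | j ≟ i
    ... | yes _   | yes _   = refl
    ... | yes i≡j | no  j≢i = contradiction (sym i≡j) j≢i
    ... | no  i≢j | yes j≡i = contradiction (sym j≡i) i≢j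
    ... | no  _   | no  _   = cong not (Graph.sym H i j)
    irreflᶜ : ∀ i → adjᶜ i i ≡ false
    irreflᶜ i with i ≟ i
    ... | yes _   = refl
    ... | no  i≢i = contradiction refl i≢i

  complement-adj : ∀ {n} (H : Graph n) {i j} → i ≢ j → adj H i j ≡ false →
                   adj (complement H) i j ≡ true
  complement-adj H {i} {j} i≢j ¬adj with i ≟ j
  ... | yes i≡j = contradiction i≡j i≢j
  ... | no  _   rewrite ¬adj = refl

  adjMatrix-complement : ∀ {n} (H : Graph n) i j →
                         adjMatrix (complement H) i j ≡ 1ℚ - adjMatrixPlusId H i j
  adjMatrix-complement H i j with i ≟ j
  ... | yes _ = refl
  ... | no  _ with adj H i j
  ...   | true  = refl
  ...   | false = refl

  properColoring? : ∀ {n} (G : Graph n) k → Dec (ProperColoring G k)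
  properColoring? {n} G k = any-function? n proper-cong λ col →
    all? λ i → all? λ j → (adj G i j ≟ᵇ true) →-dec ¬? (col i ≟ col j)
    where
    proper-cong : ∀ {f g : Fin n → Fin k} → (∀ i → f i ≡ g i) →
                  (∀ i j → adj G i j ≡ true → f i ≢ f j) → ∀ i j → adj G i j ≡ true → g i ≢ g j
    proper-cong f≗g f-proper i j ij gi≡gj =
      f-proper i j ij (trans (f≗g i) (trans gi≡gj (sym (f≗g j))))

  identityColoring : ∀ {n} (G : Graph n) → ProperColoring G n
  identityColoring G = id , λ { i j ij refl → contradiction (trans (sym ij) (irrefl G i)) λ () }

  chromaticNumber-exists : ∀ {n} (G : Graph n) → Σ ℕ (IsChromaticNumber G)
  chromaticNumber-exists G = least (properColoring? G) (identityColoring G)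

  clique-size≤ : ∀ {n m d} {G : Graph n} {f : Fin m → Fin n} →
                 CliqueNumberAtMost G d → IsClique G f → m ≤ d
  clique-size≤ {m = m} {d} {f = f} ω≤d clique with m ≤? d
  ... | yes m≤d = m≤d
  ... | no  m≰d =
    contradiction (f ∘ ι , λ a b a≢b → clique (ι a) (ι b) (a≢b ∘ inject≤-injective _ _ a b)) ω≤d
    where
    ι : Fin (suc d) → Fin m
    ι t = inject≤ t (≰⇒> m≰d)

  lookup-injective : ∀ {A : Set} {xs : List A} → Unique xs →
                     ∀ {i j} → lookup xs i ≡ lookup xs j → i ≡ j
  lookup-injective (_      ∷ _) {zero}  {zero}  _ = refl
  lookup-injective (x∉xs   ∷ _) {zero}  {suc j} e = contradiction e (All.lookup x∉xs (∈-lookup j))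
  lookup-injective (x∉xs   ∷ _) {suc i} {zero}  e = contradiction (sym e) (All.lookup x∉xs (∈-lookup i))
  lookup-injective (_ ∷ unique) {suc i} {suc j} e = cong suc (lookup-injective unique e)

  length-filter-∁ : ∀ {A : Set} {P : A → Set} (P? : Decidable P) xs →
                    length xs ≡ length (filter P? xs) + length (filter (¬? ∘ P?) xs)
  length-filter-∁ P? []       = refl
  length-filter-∁ P? (x ∷ xs) with P? x
  ... | yes _ = cong suc (length-filter-∁ P? xs)
  ... | no  _ = trans (cong suc (length-filter-∁ P? xs)) (sym (+-suc _ _))

  module _ {A : Set} (f : A → ℕ) {d : ℕ}
           (fibre≤ : ∀ b {ys} → Unique ys → All (λ y → f y ≡ b) ys → length ys ≤ d) where

    length≤c*d : ∀ c {xs} → Unique xs → All (λ x → f x < c) xs → length xs ≤ c * d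
    length≤c*d zero    {[]}    _ _        = z≤n
    length≤c*d zero    {_ ∷ _} _ (() ∷ _)
    length≤c*d (suc c) {xs}    unique f<1+c = begin
      length xs
        ≡⟨ length-filter-∁ P? xs ⟩
      length (filter P? xs) + length (filter (¬? ∘ P?) xs)
        ≤⟨ +-mono-≤ (fibre≤ c (Unique.filter⁺ P? unique) (all-filter P? xs))
                    (length≤c*d c (Unique.filter⁺ (¬? ∘ P?) unique) f<c) ⟩
      d + c * d ∎
      where
      open ≤-Reasoning
      P? : Decidable (λ x → f x ≡ c)
      P? x = f x ℕ.≟ c
      f<c : All (λ x → f x < c) (filter (¬? ∘ P?) xs)
      f<c = All.zipWith (λ (f<1+c , f≢c) → ≤∧≢⇒< (≤-pred f<1+c) f≢c)
                        (filter⁺ (¬? ∘ P?) f<1+c , all-filter (¬? ∘ P?) xs)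

  monochromatic-clique : ∀ {n c} (H : Graph n) ((col , proper) : ProperColoring (complement H) c) →
    ∀ {ys} → Unique ys → (∀ a b → col (lookup ys a) ≡ col (lookup ys b)) → IsClique H (lookup ys)
  monochromatic-clique H (col , proper) {ys} unique same a b a≢b
    with adj H (lookup ys a) (lookup ys b) in ¬adj
  ... | true  = refl
  ... | false = contradiction (same a b)
                  (proper _ _ (complement-adj H (a≢b ∘ lookup-injective unique) ¬adj))

  n≤χ*ω : ∀ {n c d} (H : Graph n) → CliqueNumberAtMost H d →
          ProperColoring (complement H) c → n ≤ c * d
  n≤χ*ω {n} {c} {d} H ω≤d (col , proper) =
    subst (_≤ c * d) (length-tabulate id)
      (length≤c*d (toℕ ∘ col) fibre≤ c (Unique.allFin⁺ n) (tabulate⁺ (toℕ<n ∘ col)))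
    where
    fibre≤ : ∀ b {ys} → Unique ys → All (λ y → toℕ (col y) ≡ b) ys → length ys ≤ d
    fibre≤ b {ys} unique ≡b =
      clique-size≤ {G = H} {f = lookup ys} ω≤d (monochromatic-clique H (col , proper) unique λ a a′ →
        toℕ-injective (trans (All.lookup ≡b (∈-lookup a)) (sym (All.lookup ≡b (∈-lookup a′)))))

open import Data.Nat using (ℕ; suc; _≤_; _*_)
open import Data.Product using (Σ; _×_; _,_; proj₁)
open LinearAlgebra using (rank-exists; rank[J-M]≤1+rank[M])
open Graphs using (complement; adjMatrix-complement; chromaticNumber-exists; n≤χ*ω)

corollary3p3 : ∀ (d n : ℕ) → 1 ≤ d → 1 ≤ n → ∀ (v : ℕ) → IsNu d n v →
    Σ ℕ λ m → Σ (Graph m) λ G →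
      (Σ ℕ λ c → IsChromaticNumber G c × n ≤ c * d)
      × (Σ ℕ λ r → IsRank (adjMatrix G) r × r ≤ suc v)
corollary3p3 d n _ _ v ((H , ω≤d , rank[A+I]≡v) , _)
  with chromaticNumber-exists (complement H) | rank-exists (adjMatrix (complement H))
... | χ , isChromatic | r , isRank =
  n , complement H ,
  (χ , isChromatic , n≤χ*ω H ω≤d (proj₁ isChromatic)) ,
  (r , isRank ,
   rank[J-M]≤1+rank[M] {M = adjMatrixPlusId H} (adjMatrix-complement H) rank[A+I]≡v isRank)
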